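{- Let $P$ be a full program and let $\Gamma\cup\{A\}$ be a set of formulas whose free variables are among $\vec{x}=x_1,\dots,x_n$. If $\mathbf{A}(P)\vdash_{pr}\Gamma\Rightarrow A$ and all primitive recursive function symbols occurring in the derivation occur in $P$, then $\overline{\mathbf{IT}}(\mathbb{N}),\forall P\vdash \mathsf{N}(x_1)\wedge\dots\wedge\mathsf N(x_n),\Gamma^{\mathsf{N}}\Rightarrow A^{\mathsf{N}}$.
   Context: For a set $P$ of first-order equations, let $\mathcal{L}$ be the language of $P$ together with $\mathsf{0}$ and unary $\mathsf{S}$. The theory $\mathbf{A}(P)$ is the first-order theory with equality in $\mathcal{L}$ with axioms: universal closures of the equations in $P$ (denoted $\forall P$); separation axioms $\forall x\;\mathsf{S}(x)\neq\mathsf{0}$, $\forall x,y\;(\mathsf{S}(x)=\mathsf{S}(y)\to x=y)$; induction $A[\mathsf{0}]\to\forall x\,(A[x]\to A[\mathsf{S}(x)])\to\forall x\,A[x]$ for all formulas $A$ of $\mathcal L$. Derivations are in classical natural deduction with the usual quantifier rules and equality rules (from $A[t]$ and $t=s$ infer $A[s]$; $t=t$). $\mathrm{PR}$ is the set of standard defining equations of all primitive recursive functions; a term is primitive recursive if it is in the language of $\mathrm{PR}$. $P$ is full if whenever it contains a function symbol corresponding to a primitive recursive function, it contains all the $\mathrm{PR}$ defining equations for that function. $T\vdash_{pr}\Gamma\Rightarrow A$ means there is a classical natural deduction derivation in $T$ of $A$ from open assumptions $\Gamma$ in which every term used in a $\forall$-elimination or $\exists$-introduction rule is primitive recursive. $\overline{\mathbf{IT}}(\mathbb{N})$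 is the first-order theory with equality (ordinary unrestricted quantifier rules) with $\mathsf 0$, $\mathsf S$, a unary predicate $\mathsf N$ (plus the function symbols of $P$), the separation axioms, and rules: infer $\mathsf N(\mathsf 0)$; from $\mathsf N(t)$ infer $\mathsf N(\mathsf S t)$; from $\mathsf N(t)$, $A[\mathsf 0]$ and $\forall x\,(A[x]\to A[\mathsf S x])$ infer $A[t]$. For a formula $A$, $A^{\mathsf N}$ is $A$ with all quantifiers relativized to $\mathsf N$: each subformula $\forall x\,B$ is replaced by $\forall x\,(\mathsf N(x)\to B)$ and each $\exists x\,B$ by $\exists x\,(\mathsf N(x)\wedge B)$; $\Gamma^{\mathsf N}=\{B^{\mathsf N}\mid B\in\Gamma\}$. -}

module Defs where

open import Data.Nat using (ℕ; zero; suc)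
open import Data.Fin using (Fin; zero; suc)
open import Data.Vec using (Vec; []; _∷_; tabulate)
import Data.Vec as Vec
open import Data.List using (List; []; _∷_; map; _++_; allFin)
open import Data.List.Membership.Propositional using (_∈_)
open import Data.Product using (Σ; _×_; _,_; proj₁; proj₂; ∃)
open import Data.Sum using (_⊎_; inj₁; inj₂)
open import Data.Unit using (⊤)
open import Data.Empty using (⊥)

data PRF : ℕ → Set where
  pzero : PRF 0
  psucc : PRF 1
  pproj : ∀ {n} → Fin n → PRF n
  pcomp : ∀ {k n} → PRF k → Vec (PRF n) k → PRF n
  prec  : ∀ {n} → PRF n → PRF (suc (suc n)) → PRF (suc n)

-- Function symbols: PR symbols, plus an arbitrary family U of further
-- (non-PR) symbols that programs may use.
Sym : (ℕ → Set) → ℕ → Set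
Sym U k = PRF k ⊎ U k

-- Well-scoped (de Bruijn) terms and formulas; Tm U n has free
-- variables among x₀ … x_{n-1}.

data Tm (U : ℕ → Set) (n : ℕ) : Set where
  var  : Fin n → Tm U n
  𝟘    : Tm U n
  𝕊    : Tm U n → Tm U n
  app  : ∀ {k} → Sym U k → Vec (Tm U n) k → Tm U n

infix 8 _≐_
infixr 7 _∧'_
infixr 6 _∨'_
infixr 5 _⇒_

data Fm (U : ℕ → Set) (n : ℕ) : Set where
  _≐_  : Tm U n → Tm U n → Fm U n
  𝐍    : Tm U n → Fm U n          -- the predicate N (only used in IT(N))
  ⊥'   : Fm U n
  _∧'_ : Fm U n → Fm U n → Fm U n
  _∨'_ : Fm U n → Fm U n → Fm U n
  _⇒_  : Fm U n → Fm U n → Fm U n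
  ∀'   : Fm U (suc n) → Fm U n
  ∃'   : Fm U (suc n) → Fm U n

¬' : ∀ {U n} → Fm U n → Fm U n
¬' A = A ⇒ ⊥'

module _ {U : ℕ → Set} where

  mutual
    ren : ∀ {n m} → (Fin n → Fin m) → Tm U n → Tm U m
    ren ρ (var i) = var (ρ i)
    ren ρ 𝟘 = 𝟘
    ren ρ (𝕊 t) = 𝕊 (ren ρ t)
    ren ρ (app f ts) = app f (rens ρ ts)

    rens : ∀ {n m k} → (Fin n → Fin m) → Vec (Tm U n) k → Vec (Tm U m) k
    rens ρ [] = []
    rens ρ (t ∷ ts) = ren ρ t ∷ rens ρ ts

  liftR : ∀ {n m} → (Fin n → Fin m) → Fin (suc n) → Fin (suc m)
  liftR ρ zero = zero
  liftR ρ (suc i) = suc (ρ i)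

  renF : ∀ {n m} → (Fin n → Fin m) → Fm U n → Fm U m
  renF ρ (t ≐ s) = ren ρ t ≐ ren ρ s
  renF ρ (𝐍 t) = 𝐍 (ren ρ t)
  renF ρ ⊥' = ⊥'
  renF ρ (A ∧' B) = renF ρ A ∧' renF ρ B
  renF ρ (A ∨' B) = renF ρ A ∨' renF ρ B
  renF ρ (A ⇒ B) = renF ρ A ⇒ renF ρ B
  renF ρ (∀' A) = ∀' (renF (liftR ρ) A)
  renF ρ (∃' A) = ∃' (renF (liftR ρ) A)

  mutual
    sub : ∀ {n m} → (Fin n → Tm U m) → Tm U n → Tm U m
    sub σ (var i) = σ i
    sub σ 𝟘 = 𝟘
    sub σ (𝕊 t) = 𝕊 (sub σ t)
    sub σ (app f ts) = app f (subs σ ts)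

    subs : ∀ {n m k} → (Fin n → Tm U m) → Vec (Tm U n) k → Vec (Tm U m) k
    subs σ [] = []
    subs σ (t ∷ ts) = sub σ t ∷ subs σ ts

  liftS : ∀ {n m} → (Fin n → Tm U m) → Fin (suc n) → Tm U (suc m)
  liftS σ zero = var zero
  liftS σ (suc i) = ren suc (σ i)

  subF : ∀ {n m} → (Fin n → Tm U m) → Fm U n → Fm U m
  subF σ (t ≐ s) = sub σ t ≐ sub σ s
  subF σ (𝐍 t) = 𝐍 (sub σ t)
  subF σ ⊥' = ⊥'
  subF σ (A ∧' B) = subF σ A ∧' subF σ B
  subF σ (A ∨' B) = subF σ A ∨' subF σ B
  subF σ (A ⇒ B) = subF σ A ⇒ subF σ B
  subF σ (∀' A) = ∀' (subF (liftS σ) A)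
  subF σ (∃' A) = ∃' (subF (liftS σ) A)

  single : ∀ {n} → Tm U n → Fin (suc n) → Tm U n
  single t zero = t
  single t (suc i) = var i

  _[_] : ∀ {n} → Fm U (suc n) → Tm U n → Fm U n
  A [ t ] = subF (single t) A

  succSub : ∀ {n} → Fin (suc n) → Tm U (suc n)
  succSub zero = 𝕊 (var zero)
  succSub (suc i) = var (suc i)

  _[𝕊x] : ∀ {n} → Fm U (suc n) → Fm U (suc n)
  A [𝕊x] = subF succSub A

  wkF : ∀ {n} → Fm U n → Fm U (suc n)
  wkF = renF suc

  wkΓ : ∀ {n} → List (Fm U n) → List (Fm U (suc n))
  wkΓ = map wkF

  closedF : ∀ {n} → Fm U 0 → Fm U n
  closedF = renF (λ ())

  rel : ∀ {n} → Fm U n → Fm U n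
  rel (t ≐ s) = t ≐ s
  rel (𝐍 t) = 𝐍 t
  rel ⊥' = ⊥'
  rel (A ∧' B) = rel A ∧' rel B
  rel (A ∨' B) = rel A ∨' rel B
  rel (A ⇒ B) = rel A ⇒ rel B
  rel (∀' A) = ∀' (𝐍 (var zero) ⇒ rel A)
  rel (∃' A) = ∃' (𝐍 (var zero) ∧' rel A)

  NHyps : (n : ℕ) → List (Fm U n)
  NHyps n = map (λ i → 𝐍 (var i)) (allFin n)

SymPred : (ℕ → Set) → Set₁
SymPred U = ∀ {k} → Sym U k → Set

module _ {U : ℕ → Set} where

  mutual
    data OccT {k} (f : Sym U k) {n} : Tm U n → Set where
      here  : ∀ {ts} → OccT f (app f ts)
      inS   : ∀ {t} → OccT f t → OccT f (𝕊 t)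
      inArg : ∀ {j} {g : Sym U j} {ts} → OccV f ts → OccT f (app g ts)

    data OccV {k} (f : Sym U k) {n} : ∀ {j} → Vec (Tm U n) j → Set where
      hd : ∀ {j t} {ts : Vec (Tm U n) j} → OccT f t → OccV f (t ∷ ts)
      tl : ∀ {j t} {ts : Vec (Tm U n) j} → OccV f ts → OccV f (t ∷ ts)

  mutual
    data TmIn (L : SymPred U) {n} : Tm U n → Set where
      var : ∀ {i} → TmIn L (var i)
      𝟘   : TmIn L 𝟘
      𝕊   : ∀ {t} → TmIn L t → TmIn L (𝕊 t)
      app : ∀ {k} {f : Sym U k} {ts} → L f → VecIn L ts → TmIn L (app f ts)

    data VecIn (L : SymPred U) {n} : ∀ {k} → Vec (Tm U n) k → Set where
      []  : VecIn L []
      _∷_ : ∀ {k t} {ts : Vec (Tm U n) k} → TmIn L t → VecIn L ts → VecIn L (t ∷ ts)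

  data FmIn (L : SymPred U) : ∀ {n} → Fm U n → Set where
    eq  : ∀ {n} {t s : Tm U n} → TmIn L t → TmIn L s → FmIn L (t ≐ s)
    𝐍   : ∀ {n} {t : Tm U n} → TmIn L t → FmIn L (𝐍 t)
    ⊥'  : ∀ {n} → FmIn L {n} ⊥'
    _∧'_ : ∀ {n} {A B : Fm U n} → FmIn L A → FmIn L B → FmIn L (A ∧' B)
    _∨'_ : ∀ {n} {A B : Fm U n} → FmIn L A → FmIn L B → FmIn L (A ∨' B)
    _⇒_ : ∀ {n} {A B : Fm U n} → FmIn L A → FmIn L B → FmIn L (A ⇒ B)
    ∀'  : ∀ {n} {A : Fm U (suc n)} → FmIn L A → FmIn L (∀' A)
    ∃'  : ∀ {n} {A : Fm U (suc n)} → FmIn L A → FmIn L (∃' A)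

  data NFree : ∀ {n} → Fm U n → Set where
    eq  : ∀ {n} {t s : Tm U n} → NFree (t ≐ s)
    ⊥'  : ∀ {n} → NFree {n} ⊥'
    _∧'_ : ∀ {n} {A B : Fm U n} → NFree A → NFree B → NFree (A ∧' B)
    _∨'_ : ∀ {n} {A B : Fm U n} → NFree A → NFree B → NFree (A ∨' B)
    _⇒_ : ∀ {n} {A B : Fm U n} → NFree A → NFree B → NFree (A ⇒ B)
    ∀'  : ∀ {n} {A : Fm U (suc n)} → NFree A → NFree (∀' A)
    ∃'  : ∀ {n} {A : Fm U (suc n)} → NFree A → NFree (∃' A)

  IsPR : SymPred U
  IsPR (inj₁ _) = ⊤
  IsPR (inj₂ _) = ⊥

  PRTerm : ∀ {n} → Tm U n → Set
  PRTerm = TmIn IsPR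

-- a first-order equation t = s with variables among x₀ … x_{k-1}
Eqn : (ℕ → Set) → Set
Eqn U = Σ ℕ (λ k → Tm U k × Tm U k)

-- a program: a (possibly infinite) set of equations
Program : (ℕ → Set) → Set₁
Program U = Eqn U → Set

module _ {U : ℕ → Set} where

  closeF : (k : ℕ) → Fm U k → Fm U 0
  closeF zero A = A
  closeF (suc k) A = closeF k (∀' A)

  ∀Eqn : Eqn U → Fm U 0
  ∀Eqn (k , t , s) = closeF k (t ≐ s)

  -- f occurs in P; the language L of P consists of these symbols (plus 0, S)
  InP : Program U → SymPred U
  InP P f = Σ (Eqn U) λ e → P e × (OccT f (proj₁ (proj₂ e)) ⊎ OccT f (proj₂ (proj₂ e)))

  vars : (n : ℕ) → Vec (Tm U n) n
  vars n = tabulate var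

  pr : ∀ {k n} → PRF k → Vec (Tm U n) k → Tm U n
  pr f ts = app (inj₁ f) ts

  data PRDef : ∀ {k} → PRF k → Eqn U → Set where
    d-zero : PRDef pzero (0 , pr pzero [] , 𝟘)
    d-succ : PRDef psucc (1 , pr psucc (var zero ∷ []) , 𝕊 (var zero))
    d-proj : ∀ {n} (i : Fin n) → PRDef (pproj i) (n , pr (pproj i) (vars n) , var i)
    d-comp : ∀ {k n} (g : PRF k) (hs : Vec (PRF n) k) →
      PRDef (pcomp g hs)
        (n , pr (pcomp g hs) (vars n) , pr g (Vec.map (λ h → pr h (vars n)) hs))
    d-rec0 : ∀ {n} (g : PRF n) (h : PRF (suc (suc n))) →
      PRDef (prec g h) (n , pr (prec g h) (𝟘 ∷ vars n) , pr g (vars n))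
    d-recS : ∀ {n} (g : PRF n) (h : PRF (suc (suc n))) →
      PRDef (prec g h)
        (suc n
        , pr (prec g h) (𝕊 (var zero) ∷ tabulate (λ i → var (suc i)))
        , pr h (var zero
                ∷ pr (prec g h) (var zero ∷ tabulate (λ i → var (suc i)))
                ∷ tabulate (λ i → var (suc i))))

  PR : Program U
  PR e = Σ ℕ λ k → Σ (PRF k) λ f → PRDef f e

  Full : Program U → Set
  Full P = ∀ {k} (f : PRF k) → InP P (inj₁ f) → ∀ e → PRDef f e → P e

record Calc (U : ℕ → Set) : Set₁ where
  field
    Ax     : ∀ {n} → Fm U n → Set
    TmOK   : ∀ {n} → Tm U n → Set   -- admissible terms for ∀E / ∃I
    FmOK   : ∀ {n} → Fm U n → Set   -- every formula in the derivation
    NRules : Set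
open Calc

module _ {U : ℕ → Set} where

  infix 3 _⊢[_]_

  -- Every rule requires its conclusion to be FmOK; since every formula of
  -- a derivation is the conclusion of some subderivation, all formulas
  -- occurring in the derivation are FmOK.
  data Der (C : Calc U) : ∀ {n} → List (Fm U n) → Fm U n → Set

  _⊢[_]_ : ∀ {n} → List (Fm U n) → Calc U → Fm U n → Set
  Γ ⊢[ C ] A = Der C Γ A

  data Der C where
    hyp  : ∀ {n Γ} {A : Fm U n} → A ∈ Γ → FmOK C A → Γ ⊢[ C ] A
    ax   : ∀ {n Γ} {A : Fm U n} → Ax C A → FmOK C A → Γ ⊢[ C ] A
    ∧I   : ∀ {n Γ} {A B : Fm U n} → Γ ⊢[ C ] A → Γ ⊢[ C ] B → FmOK C (A ∧' B) → Γ ⊢[ C ] A ∧' B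
    ∧E₁  : ∀ {n Γ} {A B : Fm U n} → Γ ⊢[ C ] A ∧' B → FmOK C A → Γ ⊢[ C ] A
    ∧E₂  : ∀ {n Γ} {A B : Fm U n} → Γ ⊢[ C ] A ∧' B → FmOK C B → Γ ⊢[ C ] B
    ∨I₁  : ∀ {n Γ} {A B : Fm U n} → Γ ⊢[ C ] A → FmOK C (A ∨' B) → Γ ⊢[ C ] A ∨' B
    ∨I₂  : ∀ {n Γ} {A B : Fm U n} → Γ ⊢[ C ] B → FmOK C (A ∨' B) → Γ ⊢[ C ] A ∨' B
    ∨E   : ∀ {n Γ} {A B D : Fm U n} → Γ ⊢[ C ] A ∨' B → (A ∷ Γ) ⊢[ C ] D → (B ∷ Γ) ⊢[ C ] D →
           FmOK C D → Γ ⊢[ C ] D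
    ⇒I   : ∀ {n Γ} {A B : Fm U n} → (A ∷ Γ) ⊢[ C ] B → FmOK C (A ⇒ B) → Γ ⊢[ C ] A ⇒ B
    ⇒E   : ∀ {n Γ} {A B : Fm U n} → Γ ⊢[ C ] A ⇒ B → Γ ⊢[ C ] A → FmOK C B → Γ ⊢[ C ] B
    ⊥E   : ∀ {n Γ} {A : Fm U n} → Γ ⊢[ C ] ⊥' → FmOK C A → Γ ⊢[ C ] A
    RAA  : ∀ {n Γ} {A : Fm U n} → (¬' A ∷ Γ) ⊢[ C ] ⊥' → FmOK C A → Γ ⊢[ C ] A
    ∀I   : ∀ {n Γ} {A : Fm U (suc n)} → wkΓ Γ ⊢[ C ] A → FmOK C (∀' A) → Γ ⊢[ C ] ∀' A
    ∀E   : ∀ {n Γ} {A : Fm U (suc n)} → Γ ⊢[ C ] ∀' A → (t : Tm U n) → TmOK C t →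
           FmOK C (A [ t ]) → Γ ⊢[ C ] A [ t ]
    ∃I   : ∀ {n Γ} {A : Fm U (suc n)} (t : Tm U n) → TmOK C t → Γ ⊢[ C ] A [ t ] →
           FmOK C (∃' A) → Γ ⊢[ C ] ∃' A
    ∃E   : ∀ {n Γ} {A : Fm U (suc n)} {D : Fm U n} → Γ ⊢[ C ] ∃' A →
           (A ∷ wkΓ Γ) ⊢[ C ] wkF D → FmOK C D → Γ ⊢[ C ] D
    refl : ∀ {n Γ} (t : Tm U n) → FmOK C (t ≐ t) → Γ ⊢[ C ] t ≐ t
    subst : ∀ {n Γ} (A : Fm U (suc n)) {t s : Tm U n} → Γ ⊢[ C ] A [ t ] → Γ ⊢[ C ] t ≐ s →
           FmOK C (A [ s ]) → Γ ⊢[ C ] A [ s ]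
    N0   : ∀ {n} {Γ : List (Fm U n)} → NRules C → FmOK C {n} (𝐍 𝟘) → Γ ⊢[ C ] 𝐍 𝟘
    NS   : ∀ {n Γ} {t : Tm U n} → NRules C → Γ ⊢[ C ] 𝐍 t → FmOK C (𝐍 (𝕊 t)) → Γ ⊢[ C ] 𝐍 (𝕊 t)
    Nind : ∀ {n Γ} (A : Fm U (suc n)) {t : Tm U n} → NRules C →
           Γ ⊢[ C ] 𝐍 t → Γ ⊢[ C ] A [ 𝟘 ] → Γ ⊢[ C ] ∀' (A ⇒ A [𝕊x]) →
           FmOK C (A [ t ]) → Γ ⊢[ C ] A [ t ]

module _ {U : ℕ → Set} where

  sepS0 : Fm U 0
  sepS0 = ∀' (¬' (𝕊 (var zero) ≐ 𝟘))

  sepInj : Fm U 0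
  sepInj = ∀' (∀' (𝕊 (var (suc zero)) ≐ 𝕊 (var zero) ⇒ var (suc zero) ≐ var zero))

  data AxA (P : Program U) {n} : Fm U n → Set where
    eqn  : ∀ {e} → P e → AxA P (closedF (∀Eqn e))
    sep1 : AxA P (closedF sepS0)
    sep2 : AxA P (closedF sepInj)
    ind  : (A : Fm U (suc n)) → AxA P (A [ 𝟘 ] ⇒ ∀' (A ⇒ A [𝕊x]) ⇒ ∀' A)

  data AxIT (P : Program U) {n} : Fm U n → Set where
    eqn  : ∀ {e} → P e → AxIT P (closedF (∀Eqn e))
    sep1 : AxIT P (closedF sepS0)
    sep2 : AxIT P (closedF sepInj)

  -- A(P) ⊢_pr, with all formulas in the language of P (which by
  -- construction also means every PR symbol occurring in the derivation
  -- occurs in P) and all ∀E/∃I terms primitive recursive.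
  APr : Program U → Calc U
  APr P = record
    { Ax = AxA P
    ; TmOK = λ t → PRTerm t × TmIn (InP P) t
    ; FmOK = λ A → NFree A × FmIn (InP P) A
    ; NRules = ⊥
    }

  -- IT(N), ∀P ⊢, in the language {0, S, N} ∪ symbols of P, with ordinary
  -- (unrestricted) quantifier rules.
  ITN : Program U → Calc U
  ITN P = record
    { Ax = AxIT P
    ; TmOK = TmIn (InP P)
    ; FmOK = FmIn (InP P)
    ; NRules = ⊤
    }

module Submission where

-- The propositional and
-- equality rules translate to themselves; ∀I and ∃E gain the guard N(x);
-- ∀E and ∃I at a term t additionally need N(t), which holds because t is
-- primitive recursive and every primitive recursive function occurring in
-- the full program P is provably total on N (by recursion on its code,
-- using the defining equations in P and, for recursion, N-induction).
-- The axioms of A(P) become provable: the equations and separation axioms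
-- because a closed universal formula implies its relativization, and the
-- induction axioms because relativized induction is derivable from the
-- N-induction rule.

open import Defs
open import Data.Nat using (ℕ; zero; suc)
open import Data.Fin using (Fin; zero; suc)
open import Data.Vec using (Vec; []; _∷_; tabulate; lookup)
import Data.Vec as Vec
open import Data.Vec.Properties using (tabulate∘lookup)
open import Data.List using (List; _∷_; map; _++_)
open import Data.List.Membership.Propositional using (_∈_)
open import Data.List.Membership.Propositional.Properties using (∈-map⁺; ∈-map⁻; ∈-++⁺ˡ; ∈-++⁺ʳ; ∈-allFin)
open import Data.List.Relation.Binary.Subset.Propositional using (_⊆_)
open import Data.List.Relation.Binary.Subset.Propositional.Properties using (∷⁺ʳ; map⁺)
open import Data.List.Relation.Unary.Any using (here; there)
open import Data.Product using (_,_)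
open import Data.Sum using (inj₁; inj₂)
open import Data.Unit using (tt)
open import Relation.Binary.PropositionalEquality as ≡ using (_≡_; cong; cong₂; sym; trans; module ≡-Reasoning)

module Substitution (U : ℕ → Set) where

  private variable n m p k : ℕ

  -- liftR at the symbol family U (U does not occur in the type of liftR)
  ⇑ : (Fin n → Fin m) → Fin (suc n) → Fin (suc m)
  ⇑ = liftR {U = U}

  mutual
    sub-ext : {σ τ : Fin n → Tm U m} → (∀ i → σ i ≡ τ i) → (t : Tm U n) → sub σ t ≡ sub τ t
    sub-ext e (var i) = e i
    sub-ext e 𝟘 = ≡.refl
    sub-ext e (𝕊 t) = cong 𝕊 (sub-ext e t)
    sub-ext e (app f ts) = cong (app f) (subs-ext e ts)

    subs-ext : {σ τ : Fin n → Tm U m} → (∀ i → σ i ≡ τ i) → (ts : Vec (Tm U n) k) → subs σ ts ≡ subs τ ts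
    subs-ext e [] = ≡.refl
    subs-ext e (t ∷ ts) = cong₂ _∷_ (sub-ext e t) (subs-ext e ts)

  mutual
    ren-as-sub : (ρ : Fin n → Fin m) (t : Tm U n) → ren ρ t ≡ sub (λ i → var (ρ i)) t
    ren-as-sub ρ (var i) = ≡.refl
    ren-as-sub ρ 𝟘 = ≡.refl
    ren-as-sub ρ (𝕊 t) = cong 𝕊 (ren-as-sub ρ t)
    ren-as-sub ρ (app f ts) = cong (app f) (rens-as-subs ρ ts)

    rens-as-subs : (ρ : Fin n → Fin m) (ts : Vec (Tm U n) k) → rens ρ ts ≡ subs (λ i → var (ρ i)) ts
    rens-as-subs ρ [] = ≡.refl
    rens-as-subs ρ (t ∷ ts) = cong₂ _∷_ (ren-as-sub ρ t) (rens-as-subs ρ ts)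

  mutual
    sub-id : (t : Tm U n) → sub var t ≡ t
    sub-id (var i) = ≡.refl
    sub-id 𝟘 = ≡.refl
    sub-id (𝕊 t) = cong 𝕊 (sub-id t)
    sub-id (app f ts) = cong (app f) (subs-id ts)

    subs-id : (ts : Vec (Tm U n) k) → subs var ts ≡ ts
    subs-id [] = ≡.refl
    subs-id (t ∷ ts) = cong₂ _∷_ (sub-id t) (subs-id ts)

  mutual
    sub-sub : (σ : Fin m → Tm U p) (τ : Fin n → Tm U m) (t : Tm U n) →
              sub σ (sub τ t) ≡ sub (λ i → sub σ (τ i)) t
    sub-sub σ τ (var i) = ≡.refl
    sub-sub σ τ 𝟘 = ≡.refl
    sub-sub σ τ (𝕊 t) = cong 𝕊 (sub-sub σ τ t)
    sub-sub σ τ (app f ts) = cong (app f) (subs-subs σ τ ts)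

    subs-subs : (σ : Fin m → Tm U p) (τ : Fin n → Tm U m) (ts : Vec (Tm U n) k) →
                subs σ (subs τ ts) ≡ subs (λ i → sub σ (τ i)) ts
    subs-subs σ τ [] = ≡.refl
    subs-subs σ τ (t ∷ ts) = cong₂ _∷_ (sub-sub σ τ t) (subs-subs σ τ ts)

  sub-single-wk : (t u : Tm U n) → sub (single t) (ren suc u) ≡ u
  sub-single-wk t u = begin
    sub (single t) (ren suc u)                 ≡⟨ cong (sub (single t)) (ren-as-sub suc u) ⟩
    sub (single t) (sub (λ i → var (suc i)) u) ≡⟨ sub-sub (single t) (λ i → var (suc i)) u ⟩
    sub var u                                  ≡⟨ sub-id u ⟩
    u                                          ∎
    where open ≡-Reasoning

  subs-tabulate : (σ : Fin n → Tm U m) (g : Fin k → Tm U n) → subs σ (tabulate g) ≡ tabulate (λ i → sub σ (g i))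
  subs-tabulate {k = zero} σ g = ≡.refl
  subs-tabulate {k = suc k} σ g = cong (sub σ (g zero) ∷_) (subs-tabulate σ (λ i → g (suc i)))

  rens-tabulate : (ρ : Fin n → Fin m) (g : Fin k → Tm U n) → rens ρ (tabulate g) ≡ tabulate (λ i → ren ρ (g i))
  rens-tabulate {k = zero} ρ g = ≡.refl
  rens-tabulate {k = suc k} ρ g = cong (ren ρ (g zero) ∷_) (rens-tabulate ρ (λ i → g (suc i)))

  liftS-ext : {σ τ : Fin n → Tm U m} → (∀ i → σ i ≡ τ i) → ∀ i → liftS σ i ≡ liftS τ i
  liftS-ext e zero = ≡.refl
  liftS-ext e (suc i) = cong (ren suc) (e i)

  subF-ext : {σ τ : Fin n → Tm U m} → (∀ i → σ i ≡ τ i) → (A : Fm U n) → subF σ A ≡ subF τ A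
  subF-ext e (t ≐ s) = cong₂ _≐_ (sub-ext e t) (sub-ext e s)
  subF-ext e (𝐍 t) = cong 𝐍 (sub-ext e t)
  subF-ext e ⊥' = ≡.refl
  subF-ext e (A ∧' B) = cong₂ _∧'_ (subF-ext e A) (subF-ext e B)
  subF-ext e (A ∨' B) = cong₂ _∨'_ (subF-ext e A) (subF-ext e B)
  subF-ext e (A ⇒ B) = cong₂ _⇒_ (subF-ext e A) (subF-ext e B)
  subF-ext e (∀' A) = cong ∀' (subF-ext (liftS-ext e) A)
  subF-ext e (∃' A) = cong ∃' (subF-ext (liftS-ext e) A)

  renF-as-subF : (ρ : Fin n → Fin m) (A : Fm U n) → renF ρ A ≡ subF (λ i → var (ρ i)) A
  renF-as-subF ρ (t ≐ s) = cong₂ _≐_ (ren-as-sub ρ t) (ren-as-sub ρ s)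
  renF-as-subF ρ (𝐍 t) = cong 𝐍 (ren-as-sub ρ t)
  renF-as-subF ρ ⊥' = ≡.refl
  renF-as-subF ρ (A ∧' B) = cong₂ _∧'_ (renF-as-subF ρ A) (renF-as-subF ρ B)
  renF-as-subF ρ (A ∨' B) = cong₂ _∨'_ (renF-as-subF ρ A) (renF-as-subF ρ B)
  renF-as-subF ρ (A ⇒ B) = cong₂ _⇒_ (renF-as-subF ρ A) (renF-as-subF ρ B)
  renF-as-subF ρ (∀' A) = cong ∀' (trans (renF-as-subF (⇑ ρ) A) (subF-ext lift-var A))
    where lift-var : ∀ i → var (⇑ ρ i) ≡ liftS (λ j → var (ρ j)) i
          lift-var zero = ≡.refl
          lift-var (suc i) = ≡.refl
  renF-as-subF ρ (∃' A) = cong ∃' (trans (renF-as-subF (⇑ ρ) A) (subF-ext lift-var A))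
    where lift-var : ∀ i → var (⇑ ρ i) ≡ liftS (λ j → var (ρ j)) i
          lift-var zero = ≡.refl
          lift-var (suc i) = ≡.refl

  subF-id : (A : Fm U n) → subF var A ≡ A
  subF-id (t ≐ s) = cong₂ _≐_ (sub-id t) (sub-id s)
  subF-id (𝐍 t) = cong 𝐍 (sub-id t)
  subF-id ⊥' = ≡.refl
  subF-id (A ∧' B) = cong₂ _∧'_ (subF-id A) (subF-id B)
  subF-id (A ∨' B) = cong₂ _∨'_ (subF-id A) (subF-id B)
  subF-id (A ⇒ B) = cong₂ _⇒_ (subF-id A) (subF-id B)
  subF-id (∀' A) = cong ∀' (trans (subF-ext lift-id A) (subF-id A))
    where lift-id : ∀ i → liftS var i ≡ var i
          lift-id zero = ≡.refl
          lift-id (suc i) = ≡.refl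
  subF-id (∃' A) = cong ∃' (trans (subF-ext lift-id A) (subF-id A))
    where lift-id : ∀ i → liftS var i ≡ var i
          lift-id zero = ≡.refl
          lift-id (suc i) = ≡.refl

  liftS-sub : (σ : Fin m → Tm U p) (τ : Fin n → Tm U m) →
              ∀ i → sub (liftS σ) (liftS τ i) ≡ liftS (λ j → sub σ (τ j)) i
  liftS-sub σ τ zero = ≡.refl
  liftS-sub σ τ (suc i) = begin
    sub (liftS σ) (ren suc (τ i))                  ≡⟨ cong (sub (liftS σ)) (ren-as-sub suc (τ i)) ⟩
    sub (liftS σ) (sub (λ j → var (suc j)) (τ i))  ≡⟨ sub-sub (liftS σ) (λ j → var (suc j)) (τ i) ⟩
    sub (λ j → ren suc (σ j)) (τ i)                ≡⟨ sub-ext (λ j → ren-as-sub suc (σ j)) (τ i) ⟩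
    sub (λ j → sub (λ l → var (suc l)) (σ j)) (τ i) ≡⟨ sub-sub (λ j → var (suc j)) σ (τ i) ⟨
    sub (λ j → var (suc j)) (sub σ (τ i))          ≡⟨ ren-as-sub suc (sub σ (τ i)) ⟨
    ren suc (sub σ (τ i))                          ∎
    where open ≡-Reasoning

  subF-subF : (σ : Fin m → Tm U p) (τ : Fin n → Tm U m) (A : Fm U n) →
              subF σ (subF τ A) ≡ subF (λ i → sub σ (τ i)) A
  subF-subF σ τ (t ≐ s) = cong₂ _≐_ (sub-sub σ τ t) (sub-sub σ τ s)
  subF-subF σ τ (𝐍 t) = cong 𝐍 (sub-sub σ τ t)
  subF-subF σ τ ⊥' = ≡.refl
  subF-subF σ τ (A ∧' B) = cong₂ _∧'_ (subF-subF σ τ A) (subF-subF σ τ B)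
  subF-subF σ τ (A ∨' B) = cong₂ _∨'_ (subF-subF σ τ A) (subF-subF σ τ B)
  subF-subF σ τ (A ⇒ B) = cong₂ _⇒_ (subF-subF σ τ A) (subF-subF σ τ B)
  subF-subF σ τ (∀' A) = cong ∀' (trans (subF-subF (liftS σ) (liftS τ) A) (subF-ext (liftS-sub σ τ) A))
  subF-subF σ τ (∃' A) = cong ∃' (trans (subF-subF (liftS σ) (liftS τ) A) (subF-ext (liftS-sub σ τ) A))

  subF-renF : (σ : Fin m → Tm U p) (ρ : Fin n → Fin m) (A : Fm U n) → subF σ (renF ρ A) ≡ subF (λ i → σ (ρ i)) A
  subF-renF σ ρ A = trans (cong (subF σ) (renF-as-subF ρ A)) (subF-subF σ _ A)

  renF-subF : (ρ : Fin m → Fin p) (σ : Fin n → Tm U m) (A : Fm U n) →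
              renF ρ (subF σ A) ≡ subF (λ i → ren ρ (σ i)) A
  renF-subF ρ σ A = begin
    renF ρ (subF σ A)                              ≡⟨ renF-as-subF ρ (subF σ A) ⟩
    subF (λ i → var (ρ i)) (subF σ A)              ≡⟨ subF-subF _ σ A ⟩
    subF (λ i → sub (λ j → var (ρ j)) (σ i)) A     ≡⟨ subF-ext (λ i → ren-as-sub ρ (σ i)) A ⟨
    subF (λ i → ren ρ (σ i)) A                     ∎
    where open ≡-Reasoning

  inst-liftS : (σ : Fin (suc n) → Tm U m) (A : Fm U (suc n)) →
               subF (liftS (λ i → σ (suc i))) A [ σ zero ] ≡ subF σ A
  inst-liftS σ A = trans (subF-subF _ _ A) (subF-ext pointwise A)
    where pointwise : ∀ i → sub (single (σ zero)) (liftS (λ j → σ (suc j)) i) ≡ σ i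
          pointwise zero = ≡.refl
          pointwise (suc i) = sub-single-wk (σ zero) (σ (suc i))

  inst-fresh : (A : Fm U (suc n)) → renF (⇑ suc) A [ var zero ] ≡ A
  inst-fresh A = trans (subF-renF _ _ A) (trans (subF-ext pointwise A) (subF-id A))
    where pointwise : ∀ i → single (var zero) (⇑ suc i) ≡ var i
          pointwise zero = ≡.refl
          pointwise (suc i) = ≡.refl

  inst-wk : (A : Fm U (suc n)) (t : Tm U n) → renF (⇑ suc) A [ ren suc t ] ≡ wkF (A [ t ])
  inst-wk A t = trans (subF-renF _ _ A) (trans (subF-ext pointwise A) (sym (renF-subF suc _ A)))
    where pointwise : ∀ i → single (ren suc t) (⇑ suc i) ≡ ren suc (single t i)
          pointwise zero = ≡.refl
          pointwise (suc i) = ≡.refl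

  wk-succ : (A : Fm U (suc n)) → renF (⇑ suc) (A [𝕊x]) ≡ renF (⇑ suc) A [𝕊x]
  wk-succ A = trans (renF-subF _ _ A) (trans (subF-ext pointwise A) (sym (subF-renF _ _ A)))
    where pointwise : ∀ i → ren (⇑ suc) (succSub i) ≡ succSub (⇑ suc i)
          pointwise zero = ≡.refl
          pointwise (suc i) = ≡.refl

  rel-subF : (σ : Fin n → Tm U m) (A : Fm U n) → rel (subF σ A) ≡ subF σ (rel A)
  rel-subF σ (t ≐ s) = ≡.refl
  rel-subF σ (𝐍 t) = ≡.refl
  rel-subF σ ⊥' = ≡.refl
  rel-subF σ (A ∧' B) = cong₂ _∧'_ (rel-subF σ A) (rel-subF σ B)
  rel-subF σ (A ∨' B) = cong₂ _∨'_ (rel-subF σ A) (rel-subF σ B)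
  rel-subF σ (A ⇒ B) = cong₂ _⇒_ (rel-subF σ A) (rel-subF σ B)
  rel-subF σ (∀' A) = cong (λ X → ∀' (𝐍 (var zero) ⇒ X)) (rel-subF (liftS σ) A)
  rel-subF σ (∃' A) = cong (λ X → ∃' (𝐍 (var zero) ∧' X)) (rel-subF (liftS σ) A)

  rel-renF : (ρ : Fin n → Fin m) (A : Fm U n) → rel (renF ρ A) ≡ renF ρ (rel A)
  rel-renF ρ A = begin
    rel (renF ρ A)                   ≡⟨ cong rel (renF-as-subF ρ A) ⟩
    rel (subF (λ i → var (ρ i)) A)   ≡⟨ rel-subF _ A ⟩
    subF (λ i → var (ρ i)) (rel A)   ≡⟨ renF-as-subF ρ (rel A) ⟨
    renF ρ (rel A)                   ∎
    where open ≡-Reasoning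

  relClose : (k : ℕ) → Fm U k → Fm U 0
  relClose zero E = E
  relClose (suc k) E = relClose k (∀' (𝐍 (var zero) ⇒ E))

  rel-closure : (k : ℕ) (E : Fm U k) → rel (closedF {n = n} (closeF k E)) ≡ closedF (relClose k (rel E))
  rel-closure k E = trans (rel-renF _ (closeF k E)) (cong closedF (rel-closeF k E))
    where rel-closeF : (k : ℕ) (E : Fm U k) → rel (closeF k E) ≡ relClose k (rel E)
          rel-closeF zero E = ≡.refl
          rel-closeF (suc k) E = rel-closeF k (∀' E)

module Language {U : ℕ → Set} (L : SymPred U) where

  open Substitution U
  private variable n m k : ℕ

  mutual
    sub-in : {σ : Fin n → Tm U m} → (∀ i → TmIn L (σ i)) → {t : Tm U n} → TmIn L t → TmIn L (sub σ t)
    sub-in h (var {i}) = h i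
    sub-in h 𝟘 = 𝟘
    sub-in h (𝕊 p) = 𝕊 (sub-in h p)
    sub-in h (app l v) = app l (subs-in h v)

    subs-in : {σ : Fin n → Tm U m} → (∀ i → TmIn L (σ i)) →
              {ts : Vec (Tm U n) k} → VecIn L ts → VecIn L (subs σ ts)
    subs-in h [] = []
    subs-in h (p ∷ v) = sub-in h p ∷ subs-in h v

  mutual
    ren-in : {ρ : Fin n → Fin m} {t : Tm U n} → TmIn L t → TmIn L (ren ρ t)
    ren-in var = var
    ren-in 𝟘 = 𝟘
    ren-in (𝕊 p) = 𝕊 (ren-in p)
    ren-in (app l v) = app l (rens-in v)

    rens-in : {ρ : Fin n → Fin m} {ts : Vec (Tm U n) k} → VecIn L ts → VecIn L (rens ρ ts)
    rens-in [] = []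
    rens-in (p ∷ v) = ren-in p ∷ rens-in v

  subF-in : {σ : Fin n → Tm U m} → (∀ i → TmIn L (σ i)) → {A : Fm U n} → FmIn L A → FmIn L (subF σ A)
  subF-in h (eq p q) = eq (sub-in h p) (sub-in h q)
  subF-in h (𝐍 p) = 𝐍 (sub-in h p)
  subF-in h ⊥' = ⊥'
  subF-in h (a ∧' b) = subF-in h a ∧' subF-in h b
  subF-in h (a ∨' b) = subF-in h a ∨' subF-in h b
  subF-in h (a ⇒ b) = subF-in h a ⇒ subF-in h b
  subF-in h (∀' a) = ∀' (subF-in (lift-in h) a)
    where lift-in : ∀ {σ : Fin n → Tm U m} → (∀ i → TmIn L (σ i)) → ∀ i → TmIn L (liftS σ i)
          lift-in h zero = var
          lift-in h (suc i) = ren-in (h i)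
  subF-in h (∃' a) = ∃' (subF-in (lift-in h) a)
    where lift-in : ∀ {σ : Fin n → Tm U m} → (∀ i → TmIn L (σ i)) → ∀ i → TmIn L (liftS σ i)
          lift-in h zero = var
          lift-in h (suc i) = ren-in (h i)

  succSub-in : ∀ i → TmIn L (succSub {U = U} {n = n} i)
  succSub-in zero = 𝕊 var
  succSub-in (suc i) = var

  renF-in : {ρ : Fin n → Fin m} {A : Fm U n} → FmIn L A → FmIn L (renF ρ A)
  renF-in {ρ = ρ} {A} a = ≡.subst (FmIn L) (sym (renF-as-subF ρ A)) (subF-in (λ i → var) a)

  single-in : {t : Tm U n} → TmIn L t → ∀ i → TmIn L (single t i)
  single-in p zero = p
  single-in p (suc i) = var

  rel-in : {A : Fm U n} → FmIn L A → FmIn L (rel A)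
  rel-in (eq p q) = eq p q
  rel-in (𝐍 p) = 𝐍 p
  rel-in ⊥' = ⊥'
  rel-in (a ∧' b) = rel-in a ∧' rel-in b
  rel-in (a ∨' b) = rel-in a ∨' rel-in b
  rel-in (a ⇒ b) = rel-in a ⇒ rel-in b
  rel-in (∀' a) = ∀' (𝐍 var ⇒ rel-in a)
  rel-in (∃' a) = ∃' (𝐍 var ∧' rel-in a)

  closeF-in : (k : ℕ) {E : Fm U k} → FmIn L E → FmIn L (closeF k E)
  closeF-in zero a = a
  closeF-in (suc k) a = closeF-in k (∀' a)

  tabulate-in : {g : Fin k → Tm U n} → (∀ i → TmIn L (g i)) → VecIn L (tabulate g)
  tabulate-in {k = zero} h = []
  tabulate-in {k = suc k} h = h zero ∷ tabulate-in (λ i → h (suc i))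

  mutual
    occurring-in : (t : Tm U n) → (∀ {k} {f : Sym U k} → OccT f t → L f) → TmIn L t
    occurring-in (var i) h = var
    occurring-in 𝟘 h = 𝟘
    occurring-in (𝕊 t) h = 𝕊 (occurring-in t (λ o → h (inS o)))
    occurring-in (app f ts) h = app (h here) (occurring-in-vec ts (λ o → h (inArg o)))

    occurring-in-vec : (ts : Vec (Tm U n) k) → (∀ {j} {f : Sym U j} → OccV f ts → L f) → VecIn L ts
    occurring-in-vec [] h = []
    occurring-in-vec (t ∷ ts) h = occurring-in t (λ o → h (hd o)) ∷ occurring-in-vec ts (λ o → h (tl o))

  ⇒-right : {A B : Fm U n} → FmIn L (A ⇒ B) → FmIn L B
  ⇒-right (a ⇒ b) = b
  ∧-left : {A B : Fm U n} → FmIn L (A ∧' B) → FmIn L A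
  ∧-left (a ∧' b) = a
  ∧-right : {A B : Fm U n} → FmIn L (A ∧' B) → FmIn L B
  ∧-right (a ∧' b) = b
  ∀-body : {A : Fm U (suc n)} → FmIn L (∀' A) → FmIn L A
  ∀-body (∀' a) = a
  ∃-body : {A : Fm U (suc n)} → FmIn L (∃' A) → FmIn L A
  ∃-body (∃' a) = a
  ≐-left : {t s : Tm U n} → FmIn L (t ≐ s) → TmIn L t
  ≐-left (eq p q) = p
  ≐-right : {t s : Tm U n} → FmIn L (t ≐ s) → TmIn L s
  ≐-right (eq p q) = q
  𝐍-arg : {t : Tm U n} → FmIn L (𝐍 t) → TmIn L t
  𝐍-arg (𝐍 p) = p

module Derivations {U : ℕ → Set} (C : Calc U) where

  private variable n : ℕ

  conclusion-ok : {Γ : List (Fm U n)} {A : Fm U n} → Γ ⊢[ C ] A → Calc.FmOK C A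
  conclusion-ok (hyp _ o) = o
  conclusion-ok (ax _ o) = o
  conclusion-ok (∧I _ _ o) = o
  conclusion-ok (∧E₁ _ o) = o
  conclusion-ok (∧E₂ _ o) = o
  conclusion-ok (∨I₁ _ o) = o
  conclusion-ok (∨I₂ _ o) = o
  conclusion-ok (∨E _ _ _ o) = o
  conclusion-ok (⇒I _ o) = o
  conclusion-ok (⇒E _ _ o) = o
  conclusion-ok (⊥E _ o) = o
  conclusion-ok (RAA _ o) = o
  conclusion-ok (∀I _ o) = o
  conclusion-ok (∀E _ _ _ o) = o
  conclusion-ok (∃I _ _ _ o) = o
  conclusion-ok (∃E _ _ o) = o
  conclusion-ok (refl _ o) = o
  conclusion-ok (subst _ _ _ o) = o
  conclusion-ok (N0 _ o) = o
  conclusion-ok (NS _ _ o) = o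
  conclusion-ok (Nind _ _ _ _ _ o) = o

  weaken : {Γ Δ : List (Fm U n)} {A : Fm U n} → Γ ⊆ Δ → Γ ⊢[ C ] A → Δ ⊢[ C ] A
  weaken inc (hyp m o) = hyp (inc m) o
  weaken inc (ax a o) = ax a o
  weaken inc (∧I d e o) = ∧I (weaken inc d) (weaken inc e) o
  weaken inc (∧E₁ d o) = ∧E₁ (weaken inc d) o
  weaken inc (∧E₂ d o) = ∧E₂ (weaken inc d) o
  weaken inc (∨I₁ d o) = ∨I₁ (weaken inc d) o
  weaken inc (∨I₂ d o) = ∨I₂ (weaken inc d) o
  weaken inc (∨E d e f o) = ∨E (weaken inc d) (weaken (∷⁺ʳ _ inc) e) (weaken (∷⁺ʳ _ inc) f) o
  weaken inc (⇒I d o) = ⇒I (weaken (∷⁺ʳ _ inc) d) o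
  weaken inc (⇒E d e o) = ⇒E (weaken inc d) (weaken inc e) o
  weaken inc (⊥E d o) = ⊥E (weaken inc d) o
  weaken inc (RAA d o) = RAA (weaken (∷⁺ʳ _ inc) d) o
  weaken inc (∀I d o) = ∀I (weaken (map⁺ wkF inc) d) o
  weaken inc (∀E d t p o) = ∀E (weaken inc d) t p o
  weaken inc (∃I t p d o) = ∃I t p (weaken inc d) o
  weaken inc (∃E d e o) = ∃E (weaken inc d) (weaken (∷⁺ʳ _ (map⁺ wkF inc)) e) o
  weaken inc (refl t o) = refl t o
  weaken inc (subst A d e o) = subst A (weaken inc d) (weaken inc e) o
  weaken inc (N0 r o) = N0 r o
  weaken inc (NS r d o) = NS r (weaken inc d) o
  weaken inc (Nind A r d e f o) = Nind A r (weaken inc d) (weaken inc e) (weaken inc f) o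

  cast : {Γ : List (Fm U n)} {A B : Fm U n} → A ≡ B → Γ ⊢[ C ] A → Γ ⊢[ C ] B
  cast = ≡.subst (_ ⊢[ C ]_)

module DerivedRules {U : ℕ → Set} (P : Program U) where

  open Substitution U
  open Language (InP P)
  open Derivations (ITN P)
  private
    variable n m k : ℕ
    L : SymPred U
    L = InP P

  infix 3 _⊩_
  _⊩_ : List (Fm U n) → Fm U n → Set
  Γ ⊩ A = Γ ⊢[ ITN P ] A

  private variable Γ Δ : List (Fm U n)

  -- The rules of IT(N), ∀P with their language side conditions computed
  -- from the premises.
  ∀I' : {A : Fm U (suc n)} → wkΓ Γ ⊩ A → Γ ⊩ ∀' A
  ∀I' d = ∀I d (∀' (conclusion-ok d))

  ∀E' : {A : Fm U (suc n)} → Γ ⊩ ∀' A → (t : Tm U n) → TmIn L t → Γ ⊩ A [ t ]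
  ∀E' d t p = ∀E d t p (subF-in (single-in p) (∀-body (conclusion-ok d)))

  ⇒I' : {A B : Fm U n} → FmIn L A → (A ∷ Γ) ⊩ B → Γ ⊩ A ⇒ B
  ⇒I' a d = ⇒I d (a ⇒ conclusion-ok d)

  ⇒E' : {A B : Fm U n} → Γ ⊩ A ⇒ B → Γ ⊩ A → Γ ⊩ B
  ⇒E' d e = ⇒E d e (⇒-right (conclusion-ok d))

  ∧I' : {A B : Fm U n} → Γ ⊩ A → Γ ⊩ B → Γ ⊩ A ∧' B
  ∧I' d e = ∧I d e (conclusion-ok d ∧' conclusion-ok e)

  ∧E₁' : {A B : Fm U n} → Γ ⊩ A ∧' B → Γ ⊩ A
  ∧E₁' d = ∧E₁ d (∧-left (conclusion-ok d))

  ∧E₂' : {A B : Fm U n} → Γ ⊩ A ∧' B → Γ ⊩ B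
  ∧E₂' d = ∧E₂ d (∧-right (conclusion-ok d))

  N0' : Γ ⊩ 𝐍 𝟘
  N0' = N0 tt (𝐍 𝟘)

  NS' : {t : Tm U n} → Γ ⊩ 𝐍 t → Γ ⊩ 𝐍 (𝕊 t)
  NS' d = NS tt d (𝐍 (𝕊 (𝐍-arg (conclusion-ok d))))

  split-conjunction : {A B D : Fm U n} → FmIn L (B ∧' A) → (A ∷ B ∷ Δ) ⊩ D → (B ∧' A ∷ Δ) ⊩ D
  split-conjunction ok@(b ∧' a) d = ⇒E' (⇒E' (weaken there (⇒I' b (⇒I' a d))) (∧E₁' both)) (∧E₂' both)
    where both = hyp (here ≡.refl) ok

  ∀E-fresh : {A : Fm U (suc n)} → Δ ⊩ wkF (∀' A) → Δ ⊩ A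
  ∀E-fresh {A = A} d = cast (inst-fresh A) (∀E' d (var zero) var)

  ≐-sym : {t s : Tm U n} → Γ ⊩ t ≐ s → Γ ⊩ s ≐ t
  ≐-sym {t = t} {s} e =
    cast (cong (s ≐_) (sub-single-wk s t))
      (subst (var zero ≐ ren suc t)
        (cast (cong (t ≐_) (sym (sub-single-wk t t))) (refl t (eq t-in t-in)))
        e
        (eq s-in (≡.subst (TmIn L) (sym (sub-single-wk s t)) t-in)))
    where t-in = ≐-left (conclusion-ok e)
          s-in = ≐-right (conclusion-ok e)

  N-backward : {t s : Tm U n} → Γ ⊩ t ≐ s → Γ ⊩ 𝐍 s → Γ ⊩ 𝐍 t
  N-backward e d = subst (𝐍 (var zero)) d (≐-sym e) (𝐍 (≐-left (conclusion-ok e)))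

  -- Induction restricted to N, as a rule: from N(t), B(0) and a derivation
  -- of B(S x) from N(x), B(x), infer B(t).  It is the N-induction rule for
  -- the invariant N(x) ∧ B(x).
  N-induction : (B : Fm U (suc n)) {t : Tm U n} → FmIn L B →
                Γ ⊩ 𝐍 t → Γ ⊩ B [ 𝟘 ] → (B ∷ 𝐍 (var zero) ∷ wkΓ Γ) ⊩ B [𝕊x] → Γ ⊩ B [ t ]
  N-induction B okB nt base step =
    ∧E₂' (Nind (𝐍 (var zero) ∧' B) tt nt (∧I' N0' base) invariant-step
               (subF-in (single-in (𝐍-arg (conclusion-ok nt))) ok))
    where
    ok = 𝐍 var ∧' okB
    invariant-step = ∀I' (⇒I' ok (∧I' (NS' (∧E₁' (hyp (here ≡.refl) ok))) (split-conjunction ok step)))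

  relativized-induction : (B : Fm U (suc n)) → FmIn L B →
    Γ ⊩ B [ 𝟘 ] ⇒ ∀' (𝐍 (var zero) ⇒ B ⇒ B [𝕊x]) ⇒ ∀' (𝐍 (var zero) ⇒ B)
  relativized-induction {n} {Γ} B okB =
    ⇒I' base-ok (⇒I' step-ok (∀I' (⇒I' (𝐍 var)
      (cast (inst-fresh B) (N-induction B' okB' (hyp (here ≡.refl) (𝐍 var)) base step)))))
    where
    base-hyp = B [ 𝟘 ]
    step-hyp = ∀' (𝐍 (var zero) ⇒ B ⇒ B [𝕊x])
    base-ok = subF-in (single-in 𝟘) okB
    step-ok = ∀' (𝐍 var ⇒ okB ⇒ subF-in succSub-in okB)
    -- B with its parameters shifted past the new variable x₀, so that B'[x₀] = B
    B' : Fm U (suc (suc n))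
    B' = renF (⇑ suc) B
    okB' = renF-in okB
    Θ : List (Fm U (suc n))
    Θ = 𝐍 (var zero) ∷ wkΓ (step-hyp ∷ base-hyp ∷ Γ)
    base : Θ ⊩ B' [ 𝟘 ]
    base = cast (sym (inst-wk B 𝟘)) (hyp (there (there (here ≡.refl))) (renF-in base-ok))
    step-instance : (B' ∷ 𝐍 (var zero) ∷ wkΓ Θ) ⊩ 𝐍 (var zero) ⇒ B' ⇒ B' [𝕊x]
    step-instance = ∀E-fresh (cast (cong (λ X → wkF (∀' (𝐍 (var zero) ⇒ B' ⇒ X))) (wk-succ B))
                                   (hyp (there (there (there (here ≡.refl)))) (renF-in (renF-in step-ok))))
    step : (B' ∷ 𝐍 (var zero) ∷ wkΓ Θ) ⊩ B' [𝕊x]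
    step = ⇒E' (⇒E' step-instance (hyp (there (here ≡.refl)) (𝐍 var))) (hyp (here ≡.refl) okB')

  close-elim : (k : ℕ) (E : Fm U k) (σ : Fin k → Tm U n) → (∀ i → TmIn L (σ i)) →
               Γ ⊩ closedF (closeF k E) → Γ ⊩ subF σ E
  close-elim zero E σ h d = cast (trans (renF-as-subF _ E) (subF-ext (λ ()) E)) d
  close-elim (suc k) E σ h d =
    cast (inst-liftS σ E) (∀E' (close-elim k (∀' E) (λ i → σ (suc i)) (λ i → h (suc i)) d) (σ zero) (h zero))

  rel-close-elim : (k : ℕ) (E : Fm U k) (σ : Fin k → Tm U n) → (∀ i → Γ ⊩ 𝐍 (σ i)) →
                   Γ ⊩ closedF (relClose k E) → Γ ⊩ subF σ E
  rel-close-elim zero E σ nσ d = cast (trans (renF-as-subF _ E) (subF-ext (λ ()) E)) d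
  rel-close-elim (suc k) E σ nσ d =
    cast (inst-liftS σ E)
      (⇒E' (∀E' (rel-close-elim k _ (λ i → σ (suc i)) (λ i → nσ (suc i)) d)
                (σ zero) (𝐍-arg (conclusion-ok (nσ zero))))
           (nσ zero))

  N-assumed : (Fin k → Fin m) → List (Fm U m) → Set
  N-assumed ρ Δ = ∀ i → 𝐍 (var (ρ i)) ∈ Δ

  rel-close-intro : (k : ℕ) (E : Fm U k) →
    (∀ {m} {Δ : List (Fm U m)} (ρ : Fin k → Fin m) → N-assumed ρ Δ → Δ ⊩ renF ρ E) →
    Γ ⊩ closedF (relClose k E)
  rel-close-intro zero E H = H _ (λ ())
  rel-close-intro (suc k) E H = rel-close-intro k _ (λ ρ mem → ∀I' (⇒I' (𝐍 var) (H (⇑ ρ) (lift-mem mem))))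
    where lift-mem : {ρ : Fin k → Fin m} {Δ : List (Fm U m)} → N-assumed ρ Δ → N-assumed (⇑ ρ) (𝐍 (var zero) ∷ wkΓ Δ)
          lift-mem mem zero = here ≡.refl
          lift-mem mem (suc i) = there (∈-map⁺ wkF (mem i))

  relativized-closed-axiom : (k : ℕ) (E : Fm U k) → (∀ {m} → AxIT P {m} (closedF (closeF k E))) → FmIn L E →
                             Γ ⊩ closedF (relClose k E)
  relativized-closed-axiom k E axiom okE = rel-close-intro k E at-variables
    where at-variables : ∀ {m} {Δ : List (Fm U m)} (ρ : Fin k → Fin m) → N-assumed ρ Δ → Δ ⊩ renF ρ E
          at-variables ρ _ = cast (sym (renF-as-subF ρ E))
                                  (close-elim k E _ (λ _ → var) (ax axiom (renF-in (closeF-in k okE))))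

  equation-in : {l r : Tm U k} → P (k , l , r) → FmIn L (l ≐ r)
  equation-in {l = l} {r} pe = eq (occurring-in l (λ o → (_ , pe , inj₁ o))) (occurring-in r (λ o → (_ , pe , inj₂ o)))

  N-by-equation : {l r : Tm U k} → P (k , l , r) → (σ : Fin k → Tm U n) → (∀ i → TmIn L (σ i)) →
                  {t s : Tm U n} → sub σ l ≡ t → sub σ r ≡ s → Γ ⊩ 𝐍 s → Γ ⊩ 𝐍 t
  N-by-equation {k = k} {l = l} {r = r} pe σ h ≡.refl ≡.refl =
    N-backward (close-elim k (l ≐ r) σ h (ax (eqn pe) (renF-in (closeF-in k (equation-in pe)))))

module Totality {U : ℕ → Set} (P : Program U) (full : Full P) where

  open Substitution U
  open Language (InP P)
  open Derivations (ITN P)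
  open DerivedRules P
  private
    variable n k j : ℕ
    L : SymPred U
    L = InP P

  Total : PRF k → Set
  Total {k} f = ∀ {n} {Γ : List (Fm U n)} (σ : Fin k → Tm U n) → (∀ i → Γ ⊩ 𝐍 (σ i)) →
                Γ ⊩ 𝐍 (pr f (tabulate σ))

  TotalOnVariables : PRF k → Set
  TotalOnVariables {k} f = ∀ {m} {Δ : List (Fm U m)} (ρ : Fin k → Fin m) → N-assumed ρ Δ →
                           Δ ⊩ 𝐍 (pr f (tabulate (λ i → var (ρ i))))

  -- Closing over the variables and instantiating shows that totality at
  -- variables is totality.
  total : {f : PRF k} → TotalOnVariables f → Total f
  total {k} {f} on-variables σ nσ =
    cast (cong (λ ts → 𝐍 (pr f ts)) (subs-tabulate σ var)) (rel-close-elim k E σ nσ (rel-close-intro k E at-variables))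
    where
    E = 𝐍 (pr f (vars k))
    at-variables : ∀ {m} {Δ : List (Fm U m)} (ρ : Fin k → Fin m) → N-assumed ρ Δ → Δ ⊩ renF ρ E
    at-variables ρ mem = cast (cong (λ ts → 𝐍 (pr f ts)) (sym (rens-tabulate ρ var))) (on-variables ρ mem)

  vars-instance : (σ : Fin k → Tm U n) → subs σ (vars k) ≡ tabulate σ
  vars-instance σ = subs-tabulate σ var

  composition-instance : (σ : Fin k → Tm U n) (hs : Vec (PRF k) j) →
    subs σ (Vec.map (λ h → pr h (vars k)) hs) ≡ tabulate (λ i → pr (lookup hs i) (tabulate σ))
  composition-instance σ [] = ≡.refl
  composition-instance σ (h ∷ hs) = cong₂ _∷_ (cong (pr h) (vars-instance σ)) (composition-instance σ hs)

  occurs-composed : (hs : Vec (PRF k) j) (i : Fin j) →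
                    OccV (inj₁ (lookup hs i)) (Vec.map (λ h → pr {U = U} h (vars k)) hs)
  occurs-composed (h ∷ hs) zero = hd here
  occurs-composed (h ∷ hs) (suc i) = tl (occurs-composed hs i)

  -- Primitive recursion preserves totality, by N-induction on the
  -- recursion argument with the parameters fixed.
  prec-total : (g : PRF k) (h : PRF (suc (suc k))) → L (inj₁ (prec g h)) →
               TotalOnVariables g → TotalOnVariables h → TotalOnVariables (prec g h)
  prec-total {k} g h lf g-total h-total {m} {Δ} ρ mem =
    cast (cong (λ ts → 𝐍 (F (var (ρ zero) ∷ ts))) (subs-tabulate _ _))
      (N-induction B (𝐍 (app lf (var ∷ params-in))) (hyp (mem zero) (𝐍 var)) base step)
    where
    F : ∀ {n} → Vec (Tm U n) (suc k) → Tm U n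
    F = pr (prec g h)
    rec-zero = full (prec g h) lf _ (d-rec0 g h)
    rec-succ = full (prec g h) lf _ (d-recS g h)
    -- the parameters, shifted past the recursion variable x₀
    params : Vec (Tm U (suc m)) k
    params = tabulate (λ i → var (suc (ρ (suc i))))
    params-in : VecIn L params
    params-in = tabulate-in (λ _ → var)
    B = 𝐍 (F (var zero ∷ params))
    σ₀ : Fin k → Tm U m
    σ₀ i = var (ρ (suc i))
    base : Δ ⊩ B [ 𝟘 ]
    base = N-by-equation rec-zero σ₀ (λ _ → var)
             (cong (λ ts → F (𝟘 ∷ ts)) (trans (vars-instance σ₀) (sym (subs-tabulate _ _))))
             (cong (pr g) (vars-instance σ₀))
             (g-total (λ i → ρ (suc i)) (λ i → mem (suc i)))
    σₛ : Fin (suc k) → Tm U (suc m)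
    σₛ zero = var zero
    σₛ (suc i) = var (suc (ρ (suc i)))
    τ : Fin (suc (suc k)) → Tm U (suc m)
    τ zero = var zero
    τ (suc zero) = F (var zero ∷ params)
    τ (suc (suc i)) = var (suc (ρ (suc i)))
    τ-in-N : ∀ i → (B ∷ 𝐍 (var zero) ∷ wkΓ Δ) ⊩ 𝐍 (τ i)
    τ-in-N zero = hyp (there (here ≡.refl)) (𝐍 var)
    τ-in-N (suc zero) = hyp (here ≡.refl) (𝐍 (app lf (var ∷ params-in)))
    τ-in-N (suc (suc i)) = hyp (there (there (∈-map⁺ wkF (mem (suc i))))) (𝐍 var)
    step : (B ∷ 𝐍 (var zero) ∷ wkΓ Δ) ⊩ B [𝕊x]
    step = N-by-equation rec-succ σₛ (λ { zero → var ; (suc i) → var })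
             (cong (λ ts → F (𝕊 (var zero) ∷ ts)) (trans (subs-tabulate σₛ _) (sym (subs-tabulate succSub _))))
             (cong (λ ts → pr h (var zero ∷ F (var zero ∷ ts) ∷ ts)) (subs-tabulate σₛ _))
             (total h-total τ τ-in-N)

  -- Totality by recursion on the code of f: each defining equation of f
  -- lies in P because P is full, and transfers N from its right-hand side.
  mutual
    total-on-variables : (f : PRF k) → L (inj₁ f) → TotalOnVariables f
    total-on-variables pzero lf ρ mem =
      N-by-equation (full pzero lf _ d-zero) (λ ()) (λ ()) ≡.refl ≡.refl N0'
    total-on-variables psucc lf ρ mem =
      N-by-equation (full psucc lf _ d-succ) (λ i → var (ρ i)) (λ _ → var) ≡.refl ≡.refl
        (NS' (hyp (mem zero) (𝐍 var)))
    total-on-variables (pproj i) lf ρ mem =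
      N-by-equation (full (pproj i) lf _ (d-proj i)) (λ j → var (ρ j)) (λ _ → var)
        (cong (pr (pproj i)) (vars-instance _)) ≡.refl
        (hyp (mem i) (𝐍 var))
    total-on-variables (pcomp g hs) lf ρ mem =
      N-by-equation def (λ i → var (ρ i)) (λ _ → var)
        (cong (pr (pcomp g hs)) (vars-instance _)) (cong (pr g) (composition-instance _ hs))
        (total (total-on-variables g (_ , def , inj₂ here)) _
          (λ i → all-total-on-variables hs (λ i → _ , def , inj₂ (inArg (occurs-composed hs i))) i ρ mem))
      where def = full (pcomp g hs) lf _ (d-comp g hs)
    total-on-variables (prec g h) lf =
      prec-total g h lf (total-on-variables g (_ , rec-zero , inj₂ here)) (total-on-variables h (_ , rec-succ , inj₂ here))
      where rec-zero = full (prec g h) lf _ (d-rec0 g h)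
            rec-succ = full (prec g h) lf _ (d-recS g h)

    all-total-on-variables : (hs : Vec (PRF k) j) → (∀ i → L (inj₁ (lookup hs i))) →
                             ∀ i → TotalOnVariables (lookup hs i)
    all-total-on-variables (h ∷ hs) lhs zero = total-on-variables h (lhs zero)
    all-total-on-variables (h ∷ hs) lhs (suc i) = all-total-on-variables hs (λ i → lhs (suc i)) i

  module _ {Θ : List (Fm U n)} (N-vars : ∀ i → 𝐍 (var i) ∈ Θ) where
    mutual
      N-term : {t : Tm U n} → PRTerm t → TmIn L t → Θ ⊩ 𝐍 t
      N-term var _ = hyp (N-vars _) (𝐍 var)
      N-term 𝟘 _ = N0'
      N-term (𝕊 p) (𝕊 q) = NS' (N-term p q)
      N-term {app (inj₁ f) ts} (app _ ps) (app lf qs) =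
        cast (cong (λ us → 𝐍 (pr f us)) (tabulate∘lookup ts))
             (total (total-on-variables f lf) (lookup ts) (N-terms ps qs))
      N-term {app (inj₂ _) _} (app () _) _

      N-terms : {ts : Vec (Tm U n) k} → VecIn IsPR ts → VecIn L ts → ∀ i → Θ ⊩ 𝐍 (lookup ts i)
      N-terms (p ∷ _) (q ∷ _) zero = N-term p q
      N-terms (_ ∷ ps) (_ ∷ qs) (suc i) = N-terms ps qs i

module Translation {U : ℕ → Set} (P : Program U) (full : Full P) where

  open Substitution U
  open Language (InP P)
  open Derivations (ITN P)
  open DerivedRules P
  open Totality P full
  private
    variable n : ℕ
    L : SymPred U
    L = InP P

  record Covers (Γ Θ : List (Fm U n)) : Set where
    field
      N-vars : ∀ i → 𝐍 (var i) ∈ Θ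
      rel-assumptions : map rel Γ ⊆ Θ
  open Covers

  covers-∷ : {Γ Θ : List (Fm U n)} {A : Fm U n} → Covers Γ Θ → Covers (A ∷ Γ) (rel A ∷ Θ)
  covers-∷ c = record { N-vars = λ i → there (N-vars c i) ; rel-assumptions = ∷⁺ʳ _ (rel-assumptions c) }

  covers-wk : {Γ Θ : List (Fm U n)} → Covers Γ Θ → Covers (wkΓ Γ) (𝐍 (var zero) ∷ wkΓ Θ)
  covers-wk {Θ = Θ} c = record { N-vars = N-vars-wk ; rel-assumptions = rel-wk }
    where
    N-vars-wk : ∀ i → 𝐍 (var i) ∈ 𝐍 (var zero) ∷ wkΓ Θ
    N-vars-wk zero = here ≡.refl
    N-vars-wk (suc i) = there (∈-map⁺ wkF (N-vars c i))
    rel-wk : map rel (wkΓ _) ⊆ 𝐍 (var zero) ∷ wkΓ Θ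
    rel-wk m with ∈-map⁻ rel m
    ... | _ , m′ , ≡.refl with ∈-map⁻ wkF m′
    ...   | C , C∈Γ , ≡.refl =
            there (≡.subst (_∈ wkΓ Θ) (sym (rel-renF suc C)) (∈-map⁺ wkF (rel-assumptions c (∈-map⁺ rel C∈Γ))))

  axiom : {Θ : List (Fm U n)} {A : Fm U n} → AxA P A → FmIn L A → Θ ⊩ rel A
  axiom (eqn {k , l , r} pe) _ =
    cast (sym (rel-closure k (l ≐ r))) (relativized-closed-axiom k (l ≐ r) (eqn pe) (equation-in pe))
  axiom sep1 _ = relativized-closed-axiom 1 _ sep1 (eq (𝕊 var) 𝟘 ⇒ ⊥')
  axiom sep2 _ = relativized-closed-axiom 2 _ sep2 (eq (𝕊 var) (𝕊 var) ⇒ eq var var)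
  axiom (ind A) (_ ⇒ (_ ⇒ ∀' A-in)) =
    cast (cong₂ (λ X Y → X ⇒ ∀' (𝐍 (var zero) ⇒ rel A ⇒ Y) ⇒ ∀' (𝐍 (var zero) ⇒ rel A))
                (sym (rel-subF _ A)) (sym (rel-subF _ A)))
         (relativized-induction (rel A) (rel-in A-in))

  translate : {Γ Θ : List (Fm U n)} {A : Fm U n} → Γ ⊢[ APr P ] A → Covers Γ Θ → Θ ⊩ rel A
  translate (hyp m (_ , f)) c = hyp (rel-assumptions c (∈-map⁺ rel m)) (rel-in f)
  translate (ax a (_ , f)) c = axiom a f
  translate (∧I d e (_ , f)) c = ∧I (translate d c) (translate e c) (rel-in f)
  translate (∧E₁ d (_ , f)) c = ∧E₁ (translate d c) (rel-in f)
  translate (∧E₂ d (_ , f)) c = ∧E₂ (translate d c) (rel-in f)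
  translate (∨I₁ d (_ , f)) c = ∨I₁ (translate d c) (rel-in f)
  translate (∨I₂ d (_ , f)) c = ∨I₂ (translate d c) (rel-in f)
  translate (∨E d e₁ e₂ (_ , f)) c =
    ∨E (translate d c) (translate e₁ (covers-∷ c)) (translate e₂ (covers-∷ c)) (rel-in f)
  translate (⇒I d (_ , f)) c = ⇒I (translate d (covers-∷ c)) (rel-in f)
  translate (⇒E d e (_ , f)) c = ⇒E (translate d c) (translate e c) (rel-in f)
  translate (⊥E d (_ , f)) c = ⊥E (translate d c) (rel-in f)
  translate (RAA d (_ , f)) c = RAA (translate d (covers-∷ c)) (rel-in f)
  translate (∀I d _) c = ∀I' (⇒I' (𝐍 var) (translate d (covers-wk c)))
  translate (∀E {A = A} d t (t-pr , t-in) _) c =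
    cast (sym (rel-subF _ A)) (⇒E' (∀E' (translate d c) t t-in) (N-term (N-vars c) t-pr t-in))
  translate (∃I {A = A} t (t-pr , t-in) d (_ , f)) c =
    ∃I t t-in (∧I' (N-term (N-vars c) t-pr t-in) (cast (rel-subF _ A) (translate d c))) (rel-in f)
  translate (∃E {D = D} d e (_ , f)) c =
    ∃E witness (split-conjunction (∃-body (conclusion-ok witness)) body) (rel-in f)
    where witness = translate d c
          body = cast (rel-renF suc D) (translate e (covers-∷ (covers-wk c)))
  translate (refl t (_ , f)) c = refl t f
  translate (subst A d e (_ , f)) c =
    cast (sym (rel-subF _ A))
      (subst (rel A) (cast (rel-subF _ A) (translate d c)) (translate e c) (≡.subst (FmIn L) (rel-subF _ A) (rel-in f)))
  translate (N0 () _) c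
  translate (NS () _ _) c
  translate (Nind _ () _ _ _ _) c

lemma7 : (U : ℕ → Set) (P : Program U) → Full P →
         (n : ℕ) (Γ : List (Fm U n)) (A : Fm U n) →
         Γ ⊢[ APr P ] A →
         (NHyps n ++ map rel Γ) ⊢[ ITN P ] rel A
lemma7 U P full n Γ A d = translate d covering
  where
  open Translation P full
  covering : Covers Γ (NHyps n ++ map rel Γ)
  covering = record
    { N-vars = λ i → ∈-++⁺ˡ (∈-map⁺ (λ j → 𝐍 (var j)) (∈-allFin i))
    ; rel-assumptions = ∈-++⁺ʳ (NHyps n)
    }
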